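{- Let $G$ be a factorizable graph, $X$ an odd-maximal barrier of $G$, and $M$ a perfect matching of $G$. Let $\hat D_1,\hat D_2$ be the expansions of DM-components $D_1,D_2$ of $G_X$ with $D_1\le_X D_2$. Then for any $u\in X\cap V(\hat D_1)$ and $w\in V(\hat D_2)\setminus X$, every $M$-saturated path $P$ between $u$ and $w$ contains a vertex of $X\cap V(\hat D_2)$.
   Context: All graphs are finite. A graph is factorizable if it has a perfect matching. For factorizable $G$: an edge is allowed if it lies in some perfect matching; for each connected component $C$ of the subgraph formed by allowed edges, $G[V(C)]$ is a factor-component. An $M$-saturated path between $u$ and $v$ is a path with ends $u,v$ and an odd number of edges such that $M\cap E(P)$ is a perfect matching of $P$ and $E(P)\setminus M$ is a matching. Barriers: $q_G(X)$ = number of odd components of $G-X$; $X$ is a barrier if $q_G(X)-|X|=|V(G)|-2\nu(G)$ ($\nu$ = maximum matching size). $D_X$ = vertices of odd components of $G-X$, $C_X=V(G)\setminus X\setminus D_X$. A barrier $X$ is odd-maximal if no nonempty $Y\subseteq D_X$ makes $X\cup Y$ a barrier. With $K_1,\ldots,K_l$ the odd components of $G-X$, $G_X:=(G-C_X-E(G[X]))/V(K_1)/\cdots/V(K_l)$ (delete $C_X$, delete edges with both ends in $X$, contract each $K_i$ to a vertex), bipartite with color classes $X$ and the contracted vertices. For a bipartite factorizable graph with color classes $A,B$, DM-components are its factor-components and $\le_A$ is the reflexive–transitive closure of $\{(G_j,G_i):\text{some edge joins }B\cap V(G_j)\text{ and }A\cap V(G_i)\}$; for $G_X$ take $A=X$.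 The expansion of a DM-component $D$ of $G_X$ is the subgraph of $G$ induced by $(V(D)\cap X)\cup\bigcup V(K_i)$ over the odd components $K_i$ whose contracted vertex lies in $D$. -}

module Defs where

open import Data.Nat using (ℕ; zero; suc; _+_; _∸_) renaming (_≤_ to _≤ℕ_)
open import Data.Fin using (Fin; zero; suc; toℕ; inject₁; fromℕ) renaming (_≤_ to _≤F_)
open import Data.Product using (Σ; _×_; _,_; ∃)
open import Data.Sum using (_⊎_)
open import Data.Unit using (⊤)
open import Relation.Nullary using (¬_)
open import Relation.Binary.PropositionalEquality using (_≡_)
open import Relation.Binary.Construct.Closure.ReflexiveTransitive using (Star)

record Graph (n : ℕ) : Set₁ where
  field
    Adj    : Fin n → Fin n → Set
    sym    : ∀ {u v} → Adj u v → Adj v u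
    irrefl : ∀ {v} → ¬ Adj v v
open Graph public

VSet : ℕ → Set₁
VSet n = Fin n → Set

Rel : ℕ → Set₁
Rel n = Fin n → Fin n → Set

Rel₁ : ℕ → Set₂
Rel₁ n = Fin n → Fin n → Set₁

Odd : ℕ → Set
Odd k = Σ ℕ λ m → k ≡ suc (m + m)

HasSize : ∀ {n} → VSet n → ℕ → Set
HasSize {n} P k =
  Σ (Fin k → Fin n) λ f →
    (∀ i j → f i ≡ f j → i ≡ j) ×
    (∀ i → P (f i)) ×
    (∀ v → P v → Σ (Fin k) λ i → f i ≡ v)

IsMatchingOn : ∀ {n} → Rel n → Rel n → Set
IsMatchingOn E N =
  (∀ {u v} → N u v → E u v) ×
  (∀ {u v} → N u v → N v u) ×
  (∀ {u v w} → N u v → N u w → v ≡ w)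

IsPerfectMatchingOn : ∀ {n} → VSet n → Rel n → Rel n → Set
IsPerfectMatchingOn VS E N =
  IsMatchingOn E N × (∀ v → VS v → Σ _ λ u → N v u)

IsMatching : ∀ {n} → Graph n → Rel n → Set
IsMatching G M = IsMatchingOn (Adj G) M

Covered : ∀ {n} → Rel n → VSet n
Covered M v = Σ _ λ u → M v u

IsPerfectMatching : ∀ {n} → Graph n → Rel n → Set
IsPerfectMatching G M = IsPerfectMatchingOn (λ _ → ⊤) (Adj G) M

Factorizable : ∀ {n} → Graph n → Set₁
Factorizable G = Σ (Rel _) λ M → IsPerfectMatching G M

-- nu(G) via the number of covered vertices: c = 2 nu(G)

MaxCovered : ∀ {n} → Graph n → ℕ → Set₁
MaxCovered G c =
  (Σ (Rel _) λ M → IsMatching G M × HasSize (Covered M) c) ×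
  (∀ (M : Rel _) c′ → IsMatching G M → HasSize (Covered M) c′ → c′ ≤ℕ c)

EdgeMinus : ∀ {n} → Graph n → VSet n → Rel n
EdgeMinus G X a b = ¬ X a × ¬ X b × Adj G a b

ReachMinus : ∀ {n} → Graph n → VSet n → Rel n
ReachMinus G X = Star (EdgeMinus G X)

-- r is the (least-index) representative of an odd component of G - X
OddRep : ∀ {n} → Graph n → VSet n → VSet n
OddRep G X r =
  ¬ X r ×
  (∀ w → ReachMinus G X r w → r ≤F w) ×
  Σ ℕ λ k → HasSize (ReachMinus G X r) k × Odd k

DX : ∀ {n} → Graph n → VSet n → VSet n
DX G X v = ¬ X v × Σ _ λ r → OddRep G X r × ReachMinus G X r v

IsBarrier : ∀ {n} → Graph n → VSet n → Set₁
IsBarrier {n} G X =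
  Σ ℕ λ q → Σ ℕ λ x → Σ ℕ λ c →
    HasSize (OddRep G X) q × HasSize X x × MaxCovered G c ×
    q ≡ x + (n ∸ c)

IsOddMaximalBarrier : ∀ {n} → Graph n → VSet n → Set₁
IsOddMaximalBarrier G X =
  IsBarrier G X ×
  (∀ (Y : VSet _) → (∀ v → Y v → DX G X v) → (Σ _ λ v → Y v) →
     ¬ IsBarrier G (λ v → X v ⊎ Y v))

-- Vertices: X, and the representatives of the
-- odd components of G - X (each contracted odd component is identified
-- with its representative).

VX : ∀ {n} → Graph n → VSet n → VSet n
VX G X v = X v ⊎ OddRep G X v

XEdge : ∀ {n} → Graph n → VSet n → Rel n
XEdge G X x r = X x × OddRep G X r × Σ _ λ y → ReachMinus G X r y × Adj G x y

EX : ∀ {n} → Graph n → VSet n → Rel n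
EX G X u v = XEdge G X u v ⊎ XEdge G X v u

AllowedX : ∀ {n} → Graph n → VSet n → Rel₁ n
AllowedX {n} G X u v =
  EX G X u v ×
  Σ (Rel n) λ N → IsPerfectMatchingOn (VX G X) (EX G X) N × N u v

SameDM : ∀ {n} → Graph n → VSet n → Rel₁ n
SameDM G X = Star (AllowedX G X)

-- DM-components of G_X are represented by any of their vertices d (VX d).
-- Generating relation of ≤_X (A = X, B = contracted vertices):
-- an edge joins B ∩ V(comp a) and A ∩ V(comp b).
StepX : ∀ {n} → Graph n → VSet n → Rel₁ n
StepX G X a b =
  Σ _ λ b′ → Σ _ λ a′ →
    OddRep G X b′ × X a′ × SameDM G X a b′ × SameDM G X b a′ × EX G X b′ a′

LeX : ∀ {n} → Graph n → VSet n → Rel₁ n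
LeX G X = Star (λ a b → SameDM G X a b ⊎ StepX G X a b)

InExp : ∀ {n} → Graph n → VSet n → Fin n → Fin n → Set₁
InExp G X d v =
  (X v × SameDM G X d v) ⊎
  (Σ _ λ r → OddRep G X r × SameDM G X d r × ReachMinus G X r v)

record MSatPath {n} (G : Graph n) (M : Rel n) (u w : Fin n) : Set where
  field
    len    : ℕ
    vtx    : Fin (suc len) → Fin n
    inj    : ∀ i j → vtx i ≡ vtx j → i ≡ j
    adj    : ∀ (i : Fin len) → Adj G (vtx (inject₁ i)) (vtx (suc i))
    start  : vtx zero ≡ u
    end    : vtx (fromℕ len) ≡ w
    oddLen : Odd len
    inM    : ∀ (i : Fin len) → Σ ℕ (λ m → toℕ i ≡ m + m) →
               M (vtx (inject₁ i)) (vtx (suc i))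
    notInM : ∀ (i : Fin len) → Odd (toℕ i) →
               ¬ M (vtx (inject₁ i)) (vtx (suc i))

module Submission where

-- Since G has a perfect matching M, the barrier X has exactly as many odd
-- components as vertices.  Each odd component K has a vertex matched into X
-- (otherwise M would pair up the odd number of vertices of K among
-- themselves), so M matches X bijectively onto the odd components, and every
-- odd component contains exactly one vertex matched into X.  Along P the
-- vertices of X therefore sit at even positions only: between two visits of X
-- the path runs inside one odd component, which it entered by an M-edge from
-- X, and it cannot leave it by a second M-edge into X.  So the last vertex x
-- of P in X is M-matched into the odd component of w; that edge belongs to the
-- perfect matching of G_X induced by M, hence is allowed, and puts x into the
-- DM-component of w.

open import Defs hiding (sym)
open import Algebra.Definitions using (Involutive)
open import Data.Empty using (⊥-elim)
open import Data.Fin using (Fin; zero; suc; toℕ; inject₁; fromℕ; fromℕ<; punchIn; punchOut; _≟_)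
open import Data.Fin.Properties using (any?; injective⇒≤; toℕ-fromℕ<; punchInᵢ≢i; punchIn-injective; punchIn-punchOut; punchOut-injective) renaming (≤-antisym to ≤ᶠ-antisym)
open import Data.Nat using (ℕ; zero; suc; _+_; _*_; _∸_; _≤_; _<_; z≤n; s≤s)
open import Data.Nat.Induction using (<-rec)
open import Data.Nat.Properties using (even≢odd; +-suc; +-identityʳ; m≤n⇒m∸n≡0; ≤-refl; <⇒≤; <⇒≱; ≤∧≢⇒<; <-trans; n<1+n; 1+n≰n; m≤n⇒m≤1+n; m≤n⇒m<n∨m≡n)
open import Data.Product using (Σ; _×_; _,_; proj₁; proj₂)
open import Data.Sum using (_⊎_; inj₁; inj₂; swap) renaming (map to ⊎-map)
open import Data.Unit using (⊤; tt)
open import Function using (id; _∘_)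
open import Function.Definitions using (Injective)
open import Relation.Nullary using (¬_; Dec; yes; no; contradiction)
open import Relation.Binary.PropositionalEquality using (_≡_; _≢_; refl; sym; trans; cong; subst; subst₂; module ≡-Reasoning)
open import Relation.Binary.Construct.Closure.ReflexiveTransitive using (ε; _◅_; _◅◅_; reverse)

Even : ℕ → Set
Even k = Σ ℕ λ m → k ≡ m + m

even⇒¬odd : ∀ {k} → Even k → ¬ Odd k
even⇒¬odd (a , refl) (b , a+a≡1+b+b) =
  even≢odd a b (trans (2*m≡m+m a) (trans a+a≡1+b+b (cong suc (sym (2*m≡m+m b)))))
  where
  2*m≡m+m : ∀ m → 2 * m ≡ m + m
  2*m≡m+m m = cong (m +_) (+-identityʳ m)

even-or-odd : ∀ k → Even k ⊎ Odd k
even-or-odd zero = inj₁ (0 , refl)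
even-or-odd (suc k) with even-or-odd k
... | inj₁ (m , k≡m+m) = inj₂ (m , cong suc k≡m+m)
... | inj₂ (m , k≡1+m+m) = inj₁ (suc m , trans (cong suc k≡1+m+m) (sym (+-suc (suc m) m)))

FixedPointFree : ∀ {m} → (Fin m → Fin m) → Set
FixedPointFree σ = ∀ i → σ i ≢ i

FixedPointFreeInvolution : ℕ → Set
FixedPointFreeInvolution m = Σ (Fin m → Fin m) λ σ → Involutive _≡_ σ × FixedPointFree σ

module RemoveFixedPoint {m} (τ : Fin (suc m) → Fin (suc m)) (τ-involutive : Involutive _≡_ τ)
                        (f : Fin (suc m)) (τf≡f : τ f ≡ f) where
  open ≡-Reasoning

  f≢τ∘punchIn : ∀ i → f ≢ τ (punchIn f i)
  f≢τ∘punchIn i f≡τp = punchInᵢ≢i f i (begin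
    punchIn f i         ≡⟨ sym (τ-involutive (punchIn f i)) ⟩
    τ (τ (punchIn f i)) ≡⟨ cong τ (sym f≡τp) ⟩
    τ f                 ≡⟨ τf≡f ⟩
    f                   ∎)

  ρ : Fin m → Fin m
  ρ i = punchOut (f≢τ∘punchIn i)

  punchIn∘ρ : ∀ i → punchIn f (ρ i) ≡ τ (punchIn f i)
  punchIn∘ρ i = punchIn-punchOut (f≢τ∘punchIn i)

  ρ-involutive : Involutive _≡_ ρ
  ρ-involutive i = punchIn-injective f _ _ (begin
    punchIn f (ρ (ρ i)) ≡⟨ punchIn∘ρ (ρ i) ⟩
    τ (punchIn f (ρ i)) ≡⟨ cong τ (punchIn∘ρ i) ⟩
    τ (τ (punchIn f i)) ≡⟨ τ-involutive (punchIn f i) ⟩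
    punchIn f i         ∎)

  ρ-fixed⇒τ-fixed : ∀ i → ρ i ≡ i → τ (punchIn f i) ≡ punchIn f i
  ρ-fixed⇒τ-fixed i ρi≡i = trans (sym (punchIn∘ρ i)) (cong (punchIn f) ρi≡i)

module FixPair {m} (σ : Fin m → Fin m) (σ-involutive : Involutive _≡_ σ) (a : Fin m) where
  τ : Fin m → Fin m
  τ i with i ≟ a | i ≟ σ a
  ... | yes _ | _     = a
  ... | no _  | yes _ = σ a
  ... | no _  | no _  = σ i

  τ-fixes-a : τ a ≡ a
  τ-fixes-a with a ≟ a
  ... | yes _   = refl
  ... | no a≢a = contradiction refl a≢a

  τ-fixes-σa : τ (σ a) ≡ σ a
  τ-fixes-σa with σ a ≟ a | σ a ≟ σ a
  ... | yes σa≡a | _     = sym σa≡a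
  ... | no _     | yes _ = refl
  ... | no _     | no σa≢σa = contradiction refl σa≢σa

  τ-involutive : Involutive _≡_ τ
  τ-involutive i with i ≟ a | i ≟ σ a
  ... | yes i≡a | _        = trans τ-fixes-a (sym i≡a)
  ... | no _    | yes i≡σa = trans τ-fixes-σa (sym i≡σa)
  ... | no i≢a  | no i≢σa with σ i ≟ a | σ i ≟ σ a
  ...   | yes σi≡a | _         = contradiction (trans (sym (σ-involutive i)) (cong σ σi≡a)) i≢σa
  ...   | no _     | yes σi≡σa = contradiction (trans (sym (σ-involutive i)) (trans (cong σ σi≡σa) (σ-involutive a))) i≢a
  ...   | no _     | no _      = σ-involutive i

  τ-fixed : ∀ i → τ i ≡ i → i ≡ a ⊎ i ≡ σ a ⊎ σ i ≡ i
  τ-fixed i τi≡i with i ≟ a | i ≟ σ a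
  ... | yes i≡a | _        = inj₁ i≡a
  ... | no _    | yes i≡σa = inj₂ (inj₁ i≡σa)
  ... | no _    | no _     = inj₂ (inj₂ τi≡i)

dropPair : ∀ {m} → FixedPointFreeInvolution (suc (suc m)) → FixedPointFreeInvolution m
dropPair {m} (σ , σ-involutive , σ-fpf) = R₂.ρ , R₂.ρ-involutive , ρ₂-fpf
  where
  open FixPair σ σ-involutive zero
  module R₁ = RemoveFixedPoint τ τ-involutive zero τ-fixes-a

  0≢σ0 : zero ≢ σ zero
  0≢σ0 0≡σ0 = σ-fpf zero (sym 0≡σ0)

  b : Fin (suc m)
  b = punchOut 0≢σ0

  punchIn-b : punchIn zero b ≡ σ zero
  punchIn-b = punchIn-punchOut 0≢σ0

  ρ₁-fixes-b : R₁.ρ b ≡ b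
  ρ₁-fixes-b = punchIn-injective zero _ _
    (trans (R₁.punchIn∘ρ b) (trans (cong τ punchIn-b) (trans τ-fixes-σa (sym punchIn-b))))

  module R₂ = RemoveFixedPoint R₁.ρ R₁.ρ-involutive b ρ₁-fixes-b

  ρ₂-fpf : FixedPointFree R₂.ρ
  ρ₂-fpf i ρ₂i≡i with τ-fixed _ (R₁.ρ-fixed⇒τ-fixed _ (R₂.ρ-fixed⇒τ-fixed i ρ₂i≡i))
  ... | inj₁ p≡0          = punchInᵢ≢i zero _ p≡0
  ... | inj₂ (inj₁ p≡σ0)  = punchInᵢ≢i b i (punchIn-injective zero _ _ (trans p≡σ0 (sym punchIn-b)))
  ... | inj₂ (inj₂ fixed) = σ-fpf _ fixed

fixedPointFreeInvolution⇒even : ∀ {m} → FixedPointFreeInvolution m → Even m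
fixedPointFreeInvolution⇒even {zero} _ = 0 , refl
fixedPointFreeInvolution⇒even {suc zero} (σ , _ , σ-fpf) with σ zero | σ-fpf zero
... | zero | σ0≢0 = contradiction refl σ0≢0
fixedPointFreeInvolution⇒even {suc (suc m)} ι = 2+-even (fixedPointFreeInvolution⇒even (dropPair ι))
  where
  2+-even : Even m → Even (suc (suc m))
  2+-even (h , m≡h+h) = suc h , cong suc (trans (cong suc m≡h+h) (sym (+-suc h h)))

injective⇒surjective : ∀ {k} (φ : Fin k → Fin k) → Injective _≡_ _≡_ φ → ∀ t → Σ (Fin k) λ i → φ i ≡ t
injective⇒surjective {suc k} φ φ-injective t with any? (λ i → φ i ≟ t)
... | yes hit  = hit
... | no miss = contradiction (injective⇒≤ {f = ψ} ψ-injective) 1+n≰n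
  where
  t≢φ : ∀ i → t ≢ φ i
  t≢φ i t≡φi = miss (i , sym t≡φi)

  ψ : Fin (suc k) → Fin k
  ψ i = punchOut (t≢φ i)

  ψ-injective : Injective _≡_ _≡_ ψ
  ψ-injective {i} {j} ψi≡ψj = φ-injective (punchOut-injective (t≢φ i) (t≢φ j) ψi≡ψj)

hasSize⇒decidable : ∀ {n} {P : VSet n} {k} → HasSize P k → ∀ v → Dec (P v)
hasSize⇒decidable {P = P} (enum , _ , enum-in , enum-onto) v with any? (λ i → enum i ≟ v)
... | yes (i , enum-i≡v) = yes (subst P enum-i≡v (enum-in i))
... | no missing         = no (λ Pv → missing (enum-onto v Pv))

-- clamp l k is k read as an element of Fin (suc l), capped at l; it lets
-- positions along a path be handled as natural numbers.
clamp : (l k : ℕ) → Fin (suc l)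
clamp zero    _       = zero
clamp (suc l) zero    = zero
clamp (suc l) (suc k) = suc (clamp l k)

clamp-zero : ∀ l → clamp l 0 ≡ zero
clamp-zero zero    = refl
clamp-zero (suc l) = refl

clamp-self : ∀ l → clamp l l ≡ fromℕ l
clamp-self zero    = refl
clamp-self (suc l) = cong suc (clamp-self l)

clamp-inject₁ : ∀ {l} (i : Fin l) → clamp l (toℕ i) ≡ inject₁ i
clamp-inject₁ {suc l} zero    = refl
clamp-inject₁ {suc l} (suc i) = cong suc (clamp-inject₁ i)

clamp-suc : ∀ {l} (i : Fin l) → clamp l (suc (toℕ i)) ≡ suc i
clamp-suc {suc l} zero    = cong suc (clamp-zero l)
clamp-suc {suc l} (suc i) = cong suc (clamp-suc i)

toℕ-clamp : ∀ {l k} → k ≤ l → toℕ (clamp l k) ≡ k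
toℕ-clamp {zero}  z≤n       = refl
toℕ-clamp {suc l} z≤n       = refl
toℕ-clamp {suc l} (s≤s k≤l) = cong suc (toℕ-clamp k≤l)

module PerfectMatching {n} (G : Graph n) {M : Rel n} (pm : IsPerfectMatching G M) where
  M⊆Adj : ∀ {u v} → M u v → Adj G u v
  M⊆Adj = proj₁ (proj₁ pm)

  M-sym : ∀ {u v} → M u v → M v u
  M-sym = proj₁ (proj₂ (proj₁ pm))

  M-functional : ∀ {u v w} → M u v → M u w → v ≡ w
  M-functional = proj₂ (proj₂ (proj₁ pm))

  partner : Fin n → Fin n
  partner v = proj₁ (proj₂ pm v tt)

  partner-matched : ∀ v → M v (partner v)
  partner-matched v = proj₂ (proj₂ pm v tt)

  matched⇒partner : ∀ {u v} → M u v → v ≡ partner u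
  matched⇒partner uv = M-functional uv (partner-matched _)

  partner-involutive : Involutive _≡_ partner
  partner-involutive v = sym (matched⇒partner (M-sym (partner-matched v)))

module Components {n} (G : Graph n) (X : VSet n) where
  reach-sym : ∀ {a b} → ReachMinus G X a b → ReachMinus G X b a
  reach-sym = reverse (λ { (a∉X , b∉X , ab) → b∉X , a∉X , Graph.sym G ab })

  reach-outside : ∀ {a b} → ¬ X a → ReachMinus G X a b → ¬ X b
  reach-outside a∉X ε                    = a∉X
  reach-outside _   ((_ , b∉X , _) ◅ bc) = reach-outside b∉X bc

  oddRep-unique : ∀ {r r′ v} → OddRep G X r → OddRep G X r′ →
                  ReachMinus G X r v → ReachMinus G X r′ v → r ≡ r′
  oddRep-unique (_ , r-least , _) (_ , r′-least , _) rv r′v =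
    ≤ᶠ-antisym (r-least _ (rv ◅◅ reach-sym r′v)) (r′-least _ (r′v ◅◅ reach-sym rv))

module _ {n} (G : Graph n) {M : Rel n} (pm : IsPerfectMatching G M) {X : VSet n} (X? : ∀ v → Dec (X v)) where
  open PerfectMatching G pm
  open Components G X

  oddComponent-matchedIntoBarrier : ∀ {r} → OddRep G X r → Σ (Fin n) λ y → ReachMinus G X r y × X (partner y)
  oddComponent-matchedIntoBarrier {r} (r∉X , _ , k , (enum , enum-injective , enum-in , enum-onto) , k-odd)
    with any? (λ i → X? (partner (enum i)))
  ... | yes (i , partner∈X) = enum i , enum-in i , partner∈X
  ... | no none = ⊥-elim (even⇒¬odd (fixedPointFreeInvolution⇒even (σ , σ-involutive , σ-fpf)) k-odd)
    where
    partner-in : ∀ i → ReachMinus G X r (partner (enum i))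
    partner-in i = enum-in i ◅◅
      ((reach-outside r∉X (enum-in i) , (λ p∈X → none (i , p∈X)) , M⊆Adj (partner-matched (enum i))) ◅ ε)

    σ : Fin k → Fin k
    σ i = proj₁ (enum-onto _ (partner-in i))

    enum∘σ : ∀ i → enum (σ i) ≡ partner (enum i)
    enum∘σ i = proj₂ (enum-onto _ (partner-in i))

    σ-involutive : Involutive _≡_ σ
    σ-involutive i = enum-injective _ _
      (trans (enum∘σ (σ i)) (trans (cong partner (enum∘σ i)) (partner-involutive (enum i))))

    σ-fpf : FixedPointFree σ
    σ-fpf i σi≡i = irrefl G (subst (Adj G (enum i)) (trans (sym (enum∘σ i)) (cong enum σi≡i))
                                   (M⊆Adj (partner-matched (enum i))))

perfectMatching⇒balancedBarrier :
  ∀ {n} (G : Graph n) {M : Rel n} {X : VSet n} → IsPerfectMatching G M → IsBarrier G X →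
  Σ ℕ λ k → HasSize (OddRep G X) k × HasSize X k
perfectMatching⇒balancedBarrier {n} G {M} pm (q , x , c , oddReps , barrier , (_ , maximal) , q≡x+n∸c) =
  x , subst (HasSize _) q≡x oddReps , barrier
  where
  open ≡-Reasoning

  n≤c : n ≤ c
  n≤c = maximal M n (proj₁ pm) (id , (λ _ _ → id) , (λ v → proj₂ pm v tt) , (λ v _ → v , refl))

  q≡x : q ≡ x
  q≡x = begin
    q           ≡⟨ q≡x+n∸c ⟩
    x + (n ∸ c) ≡⟨ cong (x +_) (m≤n⇒m∸n≡0 n≤c) ⟩
    x + 0       ≡⟨ +-identityʳ x ⟩
    x           ∎

module BalancedBarrier {n} (G : Graph n) {X : VSet n} {M : Rel n} (pm : IsPerfectMatching G M)
                       {k} (oddReps : HasSize (OddRep G X) k) (barrier : HasSize X k) where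
  open PerfectMatching G pm
  open Components G X

  private
    rep : Fin k → Fin n
    rep = proj₁ oddReps

    rep-injective : ∀ i j → rep i ≡ rep j → i ≡ j
    rep-injective = proj₁ (proj₂ oddReps)

    rep-odd : ∀ i → OddRep G X (rep i)
    rep-odd = proj₁ (proj₂ (proj₂ oddReps))

    elem : Fin k → Fin n
    elem = proj₁ barrier

    elem-onto : ∀ v → X v → Σ (Fin k) λ i → elem i ≡ v
    elem-onto = proj₂ (proj₂ (proj₂ barrier))

  opaque
    X? : ∀ v → Dec (X v)
    X? = hasSize⇒decidable barrier

    exit : Fin k → Fin n
    exit i = proj₁ (oddComponent-matchedIntoBarrier G pm X? (rep-odd i))

    exit-reach : ∀ i → ReachMinus G X (rep i) (exit i)
    exit-reach i = proj₁ (proj₂ (oddComponent-matchedIntoBarrier G pm X? (rep-odd i)))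

    exit-matched : ∀ i → X (partner (exit i))
    exit-matched i = proj₂ (proj₂ (oddComponent-matchedIntoBarrier G pm X? (rep-odd i)))

  exit-injective : Injective _≡_ _≡_ exit
  exit-injective {i} {j} exit-i≡exit-j = rep-injective i j
    (oddRep-unique (rep-odd i) (rep-odd j) (exit-reach i)
                   (subst (ReachMinus G X (rep j)) (sym exit-i≡exit-j) (exit-reach j)))

  target : Fin k → Fin k
  target i = proj₁ (elem-onto _ (exit-matched i))

  exit≡partner∘elem∘target : ∀ i → exit i ≡ partner (elem (target i))
  exit≡partner∘elem∘target i =
    trans (sym (partner-involutive (exit i))) (cong partner (sym (proj₂ (elem-onto _ (exit-matched i)))))

  target-injective : Injective _≡_ _≡_ target
  target-injective {i} {j} target-i≡target-j = exit-injective
    (trans (exit≡partner∘elem∘target i)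
           (trans (cong (partner ∘ elem) target-i≡target-j) (sym (exit≡partner∘elem∘target j))))

  barrier-matchedFromExit : ∀ {v} → X v → Σ (Fin k) λ i → exit i ≡ partner v
  barrier-matchedFromExit {v} v∈X with elem-onto v v∈X
  ... | l , elem-l≡v with injective⇒surjective target target-injective l
  ...   | i , target-i≡l =
    i , trans (exit≡partner∘elem∘target i) (cong partner (trans (cong elem target-i≡l) elem-l≡v))

  partner-outside : ∀ {v} → X v → ¬ X (partner v)
  partner-outside v∈X with barrier-matchedFromExit v∈X
  ... | i , exit-i≡ = subst (λ z → ¬ X z) exit-i≡ (reach-outside (proj₁ (rep-odd i)) (exit-reach i))

  matchedIntoBarrier⇒exit : ∀ {y} → X (partner y) → Σ (Fin k) λ i → exit i ≡ y
  matchedIntoBarrier⇒exit {y} py∈X with barrier-matchedFromExit py∈X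
  ... | i , exit-i≡ = i , trans exit-i≡ (partner-involutive y)

  matchedIntoBarrier-unique : ∀ {y y′} → X (partner y) → X (partner y′) → ReachMinus G X y y′ → y ≡ y′
  matchedIntoBarrier-unique py∈X py′∈X yy′
    with matchedIntoBarrier⇒exit py∈X | matchedIntoBarrier⇒exit py′∈X
  ... | i , refl | j , refl =
    cong exit (rep-injective i j (oddRep-unique (rep-odd i) (rep-odd j) (exit-reach i ◅◅ yy′) (exit-reach j)))

  InducedArc : Rel n
  InducedArc a r = X a × OddRep G X r × Σ (Fin n) λ y → ReachMinus G X r y × M a y

  InducedMatching : Rel n
  InducedMatching a b = InducedArc a b ⊎ InducedArc b a

  inducedArc⇒edge : ∀ {a r} → InducedArc a r → XEdge G X a r
  inducedArc⇒edge (a∈X , r-odd , y , ry , ay) = a∈X , r-odd , y , ry , M⊆Adj ay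

  inducedArc-target-unique : ∀ {a r r′} → InducedArc a r → InducedArc a r′ → r ≡ r′
  inducedArc-target-unique (_ , r-odd , _ , ry , ay) (_ , r′-odd , _ , r′y′ , ay′) =
    oddRep-unique r-odd r′-odd ry (subst (ReachMinus G X _) (M-functional ay′ ay) r′y′)

  inducedArc-source-unique : ∀ {a a′ r} → InducedArc a r → InducedArc a′ r → a ≡ a′
  inducedArc-source-unique {a} {a′} (a∈X , _ , y , ry , ay) (a′∈X , _ , y′ , ry′ , a′y′) = begin
    a          ≡⟨ a≡py ⟩
    partner y  ≡⟨ cong partner y≡y′ ⟩
    partner y′ ≡⟨ sym a′≡py′ ⟩
    a′         ∎
    where
    open ≡-Reasoning
    a≡py : a ≡ partner y
    a≡py = matched⇒partner (M-sym ay)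

    a′≡py′ : a′ ≡ partner y′
    a′≡py′ = matched⇒partner (M-sym a′y′)

    y≡y′ : y ≡ y′
    y≡y′ = matchedIntoBarrier-unique (subst X a≡py a∈X) (subst X a′≡py′ a′∈X) (reach-sym ry ◅◅ ry′)

  inducedMatching-functional : ∀ {a b b′} → InducedMatching a b → InducedMatching a b′ → b ≡ b′
  inducedMatching-functional (inj₁ ab) (inj₁ ab′) = inducedArc-target-unique ab ab′
  inducedMatching-functional (inj₂ ba) (inj₂ b′a) = inducedArc-source-unique ba b′a
  inducedMatching-functional (inj₁ (a∈X , _)) (inj₂ (_ , a-odd , _)) = ⊥-elim (proj₁ a-odd a∈X)
  inducedMatching-functional (inj₂ (_ , a-odd , _)) (inj₁ (a∈X , _)) = ⊥-elim (proj₁ a-odd a∈X)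

  inducedMatching-covers : ∀ v → VX G X v → Σ (Fin n) λ v′ → InducedMatching v v′
  inducedMatching-covers v (inj₁ v∈X) with barrier-matchedFromExit v∈X
  ... | i , exit-i≡ = rep i , inj₁ (v∈X , rep-odd i , partner v ,
                                     subst (ReachMinus G X (rep i)) exit-i≡ (exit-reach i) , partner-matched v)
  inducedMatching-covers v (inj₂ v-odd) with oddComponent-matchedIntoBarrier G pm X? v-odd
  ... | y , vy , py∈X = partner y , inj₂ (py∈X , v-odd , y , vy , M-sym (partner-matched y))

  inducedMatching-perfect : IsPerfectMatchingOn (VX G X) (EX G X) InducedMatching
  inducedMatching-perfect =
    (⊎-map inducedArc⇒edge inducedArc⇒edge , swap , inducedMatching-functional) , inducedMatching-covers

  matchingEdge-allowed : ∀ {a r y} → X a → OddRep G X r → ReachMinus G X r y → M a y → AllowedX G X r a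
  matchingEdge-allowed {a} {r} a∈X r-odd ry ay =
    inj₂ (inducedArc⇒edge arc) , InducedMatching , inducedMatching-perfect , inj₂ arc
    where
    arc : InducedArc a r
    arc = a∈X , r-odd , _ , ry , ay

module SaturatedPath {n} {G : Graph n} {M : Rel n} {u w : Fin n} (P : MSatPath G M u w) where
  open MSatPath P

  V : ℕ → Fin n
  V k = vtx (clamp len k)

  private
    along : ∀ {Q : ℕ → Set} {R : Rel n} → (∀ i → Q (toℕ i) → R (vtx (inject₁ i)) (vtx (suc i))) →
            ∀ k → k < len → Q k → R (V k) (V (suc k))
    along {R = R} edge k k<len with fromℕ< k<len | toℕ-fromℕ< k<len
    ... | i | refl = subst₂ (λ a b → R (vtx a) (vtx b)) (sym (clamp-inject₁ i)) (sym (clamp-suc i)) ∘ edge i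

  V-adjacent : ∀ k → k < len → Adj G (V k) (V (suc k))
  V-adjacent k k<len = along {Q = λ _ → ⊤} {R = Adj G} (λ i _ → adj i) k k<len tt

  V-matched : ∀ k → k < len → Even k → M (V k) (V (suc k))
  V-matched = along {Q = Even} {R = M} inM

  V-injective : ∀ {k k′} → k ≤ len → k′ ≤ len → V k ≡ V k′ → k ≡ k′
  V-injective k≤len k′≤len Vk≡Vk′ =
    trans (sym (toℕ-clamp k≤len)) (trans (cong toℕ (inj _ _ Vk≡Vk′)) (toℕ-clamp k′≤len))

  V-start : V 0 ≡ u
  V-start = trans (cong vtx (clamp-zero len)) start

  V-end : V len ≡ w
  V-end = trans (cong vtx (clamp-self len)) end

module SaturatedPathFromBarrier {n} (G : Graph n) {X : VSet n} {M : Rel n} (pm : IsPerfectMatching G M)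
                                {k} (oddReps : HasSize (OddRep G X) k) (barrier : HasSize X k)
                                {u w : Fin n} (P : MSatPath G M u w) (u∈X : X u) where
  open PerfectMatching G pm
  open Components G X
  open BalancedBarrier G pm oddReps barrier
  open SaturatedPath P
  open MSatPath P using (len; vtx)

  record LastBarrierVertex (t : ℕ) : Set where
    field
      pos     : ℕ
      pos≤t   : pos ≤ t
      pos∈X   : X (V pos)
      after∉X : ∀ s → pos < s → s ≤ t → ¬ X (V s)

  lastBarrierVertex : ∀ t → LastBarrierVertex t
  lastBarrierVertex zero = record
    { pos = 0 ; pos≤t = z≤n ; pos∈X = subst X (sym V-start) u∈X
    ; after∉X = λ _ 0<s s≤0 → contradiction s≤0 (<⇒≱ 0<s) }
  lastBarrierVertex (suc t) with X? (V (suc t))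
  ... | yes last∈X = record
    { pos = suc t ; pos≤t = ≤-refl ; pos∈X = last∈X
    ; after∉X = λ _ 1+t<s s≤1+t → contradiction s≤1+t (<⇒≱ 1+t<s) }
  ... | no last∉X = record
    { pos = pos ; pos≤t = m≤n⇒m≤1+n pos≤t ; pos∈X = pos∈X ; after∉X = after∉X′ }
    where
    open LastBarrierVertex (lastBarrierVertex t)
    after∉X′ : ∀ s → pos < s → s ≤ suc t → ¬ X (V s)
    after∉X′ s pos<s s≤1+t with m≤n⇒m<n∨m≡n s≤1+t
    ... | inj₁ (s≤s s≤t) = after∉X s pos<s s≤t
    ... | inj₂ refl      = last∉X

  segment-reach : ∀ {s t} → s ≤ t → t ≤ len → (∀ j → s ≤ j → j ≤ t → ¬ X (V j)) →
                  ReachMinus G X (V s) (V t)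
  segment-reach s≤t _ _ with m≤n⇒m<n∨m≡n s≤t
  segment-reach _ _ _ | inj₂ refl = ε
  segment-reach {s} {suc t} s≤1+t t<len outside | inj₁ (s≤s s≤t) =
    segment-reach s≤t (<⇒≤ t<len) (λ j s≤j j≤t → outside j s≤j (m≤n⇒m≤1+n j≤t)) ◅◅
    ((outside t s≤t (m≤n⇒m≤1+n ≤-refl) , outside (suc t) s≤1+t ≤-refl , V-adjacent t t<len) ◅ ε)

  entry-matchedIntoBarrier : ∀ {m} → Even m → m < len → X (V m) → X (partner (V (suc m)))
  entry-matchedIntoBarrier m-even m<len m∈X =
    subst X (matched⇒partner (M-sym (V-matched _ m<len m-even))) m∈X

  barrierVertex-even : ∀ k → k ≤ len → X (V k) → Even k
  barrierVertex-even = <-rec _ step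
    where
    step : ∀ k → (∀ {j} → j < k → j ≤ len → X (V j) → Even j) → k ≤ len → X (V k) → Even k
    step k earlier k≤len k∈X with even-or-odd k
    ... | inj₁ k-even = k-even
    ... | inj₂ (h , refl) = ⊥-elim (even⇒¬odd (h , refl) (p , trans (sym 1+pos≡k₁) (cong suc pos≡p+p)))
      where
      k₁ : ℕ
      k₁ = h + h

      matched : M (V k₁) (V (suc k₁))
      matched = V-matched k₁ k≤len (h , refl)

      k₁∉X : ¬ X (V k₁)
      k₁∉X = subst (λ z → ¬ X z) (sym (matched⇒partner (M-sym matched))) (partner-outside k∈X)

      k₁-matchedIntoBarrier : X (partner (V k₁))
      k₁-matchedIntoBarrier = subst X (matched⇒partner matched) k∈X

      open LastBarrierVertex (lastBarrierVertex k₁)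

      pos<k₁ : pos < k₁
      pos<k₁ = ≤∧≢⇒< pos≤t (λ pos≡k₁ → k₁∉X (subst (X ∘ V) pos≡k₁ pos∈X))

      pos<len : pos < len
      pos<len = <-trans pos<k₁ k≤len

      pos-even : Even pos
      pos-even = earlier (<-trans pos<k₁ (n<1+n k₁)) (<⇒≤ pos<len) pos∈X

      p : ℕ
      p = proj₁ pos-even

      pos≡p+p : pos ≡ p + p
      pos≡p+p = proj₂ pos-even

      1+pos≡k₁ : suc pos ≡ k₁
      1+pos≡k₁ = V-injective pos<len (<⇒≤ k≤len)
        (matchedIntoBarrier-unique (entry-matchedIntoBarrier pos-even pos<len pos∈X) k₁-matchedIntoBarrier
                                   (segment-reach pos<k₁ (<⇒≤ k≤len) after∉X))

  barrierVertex-inDMComponentOfEnd : ∀ {d} → InExp G X d w → ¬ X w →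
                                     Σ (Fin (suc len)) λ i → X (vtx i) × InExp G X d (vtx i)
  barrierVertex-inDMComponentOfEnd (inj₁ (w∈X , _)) w∉X = ⊥-elim (w∉X w∈X)
  barrierVertex-inDMComponentOfEnd (inj₂ (r , r-odd , d~r , rw)) w∉X =
    clamp len pos , pos∈X , inj₁ (pos∈X , d~r ◅◅ (matchingEdge-allowed pos∈X r-odd r-entry matched ◅ ε))
    where
    open LastBarrierVertex (lastBarrierVertex len)

    pos<len : pos < len
    pos<len = ≤∧≢⇒< pos≤t (λ pos≡len → w∉X (subst X (trans (cong V pos≡len) V-end) pos∈X))

    matched : M (V pos) (V (suc pos))
    matched = V-matched pos pos<len (barrierVertex-even pos pos≤t pos∈X)

    r-entry : ReachMinus G X r (V (suc pos))
    r-entry = rw ◅◅ reach-sym (subst (ReachMinus G X _) V-end (segment-reach pos<len ≤-refl after∉X))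

lemma2 : ∀ {n} (G : Graph n) → Factorizable G →
           (X : VSet n) → IsOddMaximalBarrier G X →
           (M : Rel n) → IsPerfectMatching G M →
           (d₁ d₂ : Fin n) → VX G X d₁ → VX G X d₂ → LeX G X d₁ d₂ →
           (u w : Fin n) → X u → InExp G X d₁ u →
           InExp G X d₂ w → ¬ X w →
           (P : MSatPath G M u w) →
           Σ (Fin (ℕ.suc (MSatPath.len P))) λ i →
             X (MSatPath.vtx P i) × InExp G X d₂ (MSatPath.vtx P i)
lemma2 G _ X (barrier , _) M pm _ _ _ _ _ _ _ u∈X _ w∈D₂ w∉X P
  with perfectMatching⇒balancedBarrier G pm barrier
... | _ , oddReps , balanced =
  SaturatedPathFromBarrier.barrierVertex-inDMComponentOfEnd G pm oddReps balanced P u∈X w∈D₂ w∉X
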